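{- Let $L(M)=(\log A(\cdot)*\sigma_0^{ -1})(M)$. For every prime $p$ and integer $m\ge 0$, $$L(p^m)=\begin{cases}2\Big(\sum_{j=0}^{n}D(p^j)\Big)\log p&\text{if } m=2n+1,\\[4pt] \Big(\sum_{j=0}^{n-1}D(p^j)+m\,D(p^n)\Big)\log p&\text{if } m=2n.\end{cases}$$ In particular $L(p^m)\neq 0$ for every $m\ge 1$.
   Context: $D(q)$ is the number of primitive Dirichlet characters modulo $q$. For $M\in\mathbb{N}$, $A(M)=\prod \frac{qM}{(m,M/m)}$, the product running over all pairs $(m,\chi)$ with $\chi$ a primitive Dirichlet character mod $q$, $q\mid m$ and $mq\mid M$; equivalently $\log A(M)=\sum_{m\mid M}\sum_{q\mid (m,M/m)}D(q)\log\frac{qM}{(m,M/m)}$ (natural logarithm). $\sigma_0(n)$ is the number of divisors of $n$ and $\sigma_0^{ -1}$ its inverse under Dirichlet convolution $(f*h)(n)=\sum_{d\mid n}f(d)h(n/d)$. -}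

module Defs where

open import Data.Bool using (Bool; true; false; _∧_; _∨_; not; if_then_else_)
open import Data.Nat using (ℕ; zero; suc; _+_; _*_; _∸_; _^_; _≤_; _<_; _≡ᵇ_; _<ᵇ_; NonZero)
open import Data.Nat.DivMod using (_/_; _%_; _mod_)
open import Data.Nat.GCD using (gcd)
open import Data.Nat.Divisibility using (_∣?_)
open import Data.Nat.ListAction using (sum; product)
open import Data.Integer using (ℤ; +_; -[1+_])
import Data.Integer as ℤ
open import Data.List using (List; []; _∷_; map; upTo; filterᵇ; length; concatMap; _++_; foldr)
open import Data.Vec using (Vec; lookup) renaming ([] to []ᵛ; _∷_ to _∷ᵛ_)
open import Data.Maybe using (Maybe; just; nothing)
open import Data.Product using (_×_; _,_)
open import Relation.Nullary using (does)
open import Relation.Binary.PropositionalEquality using (_≡_)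

-- Total versions of division / remainder (value irrelevant for divisor 0)

_div'_ : ℕ → ℕ → ℕ
a div' zero    = 0
a div' (suc n) = a / suc n

_mod'_ : ℕ → ℕ → ℕ
a mod' zero    = a
a mod' (suc n) = a % suc n

allᵇ : {A : Set} → (A → Bool) → List A → Bool
allᵇ p = foldr (λ x b → p x ∧ b) true

divisors : ℕ → List ℕ
divisors n = filterᵇ (λ d → does (d ∣? n)) (map suc (upTo n))

σ₀ : ℕ → ℕ
σ₀ n = length (divisors n)

sumℤ : List ℤ → ℤ
sumℤ []       = + 0
sumℤ (x ∷ xs) = x ℤ.+ sumℤ xs

_⋆_ : (ℕ → ℤ) → (ℕ → ℤ) → ℕ → ℤ
(f ⋆ g) n = sumℤ (map (λ d → f d ℤ.* g (n div' d)) (divisors n))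

εᴰ : ℕ → ℤ
εᴰ n = if n ≡ᵇ 1 then + 1 else + 0

IsσInverse : (ℕ → ℤ) → Set
IsσInverse h = ∀ n → 1 ≤ n → ((λ k → + σ₀ k) ⋆ h) n ≡ εᴰ n

-- A Dirichlet character mod q (q ≥ 1) takes values in {0} ∪ μ_{φ(q)}.
-- Fixing ζ = exp(2πi/φ(q)), the value ζ^x is encoded as  just x  (x < φ(q))
-- and the value 0 as  nothing.  A character is encoded by its values on
-- the residues 0,…,q-1 (periodicity is thus built in).

φ : ℕ → ℕ
φ q = length (filterᵇ (λ k → gcd k q ≡ᵇ 1) (upTo q))

eqℕᴹ : Maybe ℕ → Maybe ℕ → Bool
eqℕᴹ nothing  nothing  = true
eqℕᴹ (just x) (just y) = x ≡ᵇ y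
eqℕᴹ _        _        = false

isNothing : Maybe ℕ → Bool
isNothing nothing  = true
isNothing (just _) = false

-- multiplication of values: ζ^x · ζ^y = ζ^{(x+y) mod φ(q)}, 0 absorbing
mulᴹ : ℕ → Maybe ℕ → Maybe ℕ → Maybe ℕ
mulᴹ e (just x) (just y) = just ((x + y) mod' e)
mulᴹ e _        _        = nothing

module _ (q' : ℕ) where
  private
    q = suc q'

  ev : Vec (Maybe ℕ) q → ℕ → Maybe ℕ
  ev v n = lookup v (n mod q)

  coprimeᵇ : ℕ → Bool
  coprimeᵇ a = gcd a q ≡ᵇ 1

  isCharᵇ : Vec (Maybe ℕ) q → Bool
  isCharᵇ v =
    allᵇ (λ a → eqBool (isNothing (ev v a)) (not (coprimeᵇ a))) (upTo q)
    ∧ allᵇ (λ a → allᵇ (λ b → eqℕᴹ (ev v (a * b)) (mulᴹ (φ q) (ev v a) (ev v b))) (upTo q)) (upTo q)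
    where
      eqBool : Bool → Bool → Bool
      eqBool true  b = b
      eqBool false b = not b

  inducedModᵇ : Vec (Maybe ℕ) q → ℕ → Bool
  inducedModᵇ v d =
    allᵇ (λ a → allᵇ (λ b →
      if coprimeᵇ a ∧ coprimeᵇ b ∧ ((a mod' d) ≡ᵇ (b mod' d))
      then eqℕᴹ (ev v a) (ev v b) else true) (upTo q)) (upTo q)

  isPrimitiveCharᵇ : Vec (Maybe ℕ) q → Bool
  isPrimitiveCharᵇ v =
    isCharᵇ v ∧ allᵇ (λ d → not (does (d ∣? q)) ∨ not (inducedModᵇ v d)) (upTo q)

allVecs : ℕ → (n : ℕ) → List (Vec (Maybe ℕ) n)
allVecs k zero    = []ᵛ ∷ []
allVecs k (suc n) =
  concatMap (λ v → map (λ o → o ∷ᵛ v) (nothing ∷ map just (upTo k))) (allVecs k n)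

D : ℕ → ℕ
D zero     = 0
D (suc q') = length (filterᵇ (isPrimitiveCharᵇ q') (allVecs (φ (suc q')) (suc q')))

-- Formal logarithms.  A value  Σ_i c_i · log n_i  (c_i ∈ ℤ, n_i ∈ ℕ⁺)
-- is represented by the list of pairs (c_i , n_i).

LogComb : Set
LogComb = List (ℤ × ℕ)

posPart negPart : ℤ → ℕ
posPart (+ n)    = n
posPart -[1+ n ] = 0
negPart (+ n)    = 0
negPart -[1+ n ] = suc n

posProd negProd : LogComb → ℕ
posProd xs = product (map (λ { (c , n) → n ^ posPart c }) xs)
negProd xs = product (map (λ { (c , n) → n ^ negPart c }) xs)

-- equality of the real numbers represented (log is injective on ℝ_{>0}):
-- Σ c_i log n_i = Σ c'_j log n'_j  ⇔  Π n_i^{c_i} = Π n'_j^{c'_j}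
_≈ᴸ_ : LogComb → LogComb → Set
x ≈ᴸ y = posProd x * negProd y ≡ posProd y * negProd x

scaleᴸ : ℤ → LogComb → LogComb
scaleᴸ c = map (λ { (a , n) → (c ℤ.* a , n) })

logA : ℕ → LogComb
logA M = concatMap (λ m →
           let g = gcd m (M div' m) in
           map (λ q → (+ D q , (q * M) div' g)) (divisors g))
         (divisors M)

Lᴬ : (ℕ → ℤ) → ℕ → LogComb
Lᴬ h M = concatMap (λ d → scaleᴸ (h (M div' d)) (logA d)) (divisors M)

sumD : ℕ → ℕ → ℕ
sumD p k = sum (map (λ j → D (p ^ j)) (upTo k))

-- At a prime power p^m every formal logarithm occurring is an integer multiple of log p, so the
-- claim is an identity between exponents of p.  As σ₀(p^a) = a + 1, the generating series of σ₀
-- along the powers of p is (1 − X)⁻², so σ₀⁻¹ takes the values 1, −2, 1, 0, 0, … there, and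
-- L(p^m) is the second difference F(m) − 2F(m − 1) + F(m − 2) of the exponent F(k) of p in A(p^k).
-- The divisor p^a of p^k contributes Σ_{j ≤ min(a, k−a)} (j + max(a, k−a)) D(p^j) to F(k).
-- Removing the terms j = 0 and re-indexing writes F(k + 2) as (Σ_a max(a, k+2−a)) · D(1) plus the
-- analogous sum for k in which D(p^j) is replaced by D(p^{j+1}) and every exponent is raised by 2.
-- The sum of maxima has second difference 1 or 2 according to parity, so induction on k (carrying
-- the extra exponent as a weight) gives the second differences of F.

module Submission where

open import Defs
open import Algebra.Structures using (IsMonoid)
open import Data.Bool using (Bool; true; false; T)
open import Data.Integer using (ℤ; +_; -[1+_]; _◃_)
import Data.Integer as ℤ
import Data.Integer.Properties as ℤ
import Data.Integer.Tactic.RingSolver as ℤ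
open import Algebra.Properties.AbelianGroup ℤ.+-0-abelianGroup using (∙-cancelʳ)
open import Data.List using ([]; _∷_; _++_; _∷ʳ_; foldr; map; applyUpTo; filterᵇ; concatMap; length)
open import Data.List.Properties
  using ( applyUpTo-∷ʳ; map-upTo; map-applyUpTo; map-++; filter-++; filter-accept; filter-none; length-applyUpTo
        ; ++-identityʳ; concatMap-pure; concatMap-map )
open import Data.List.Relation.Unary.All using (All; []; _∷_)
open import Data.List.Relation.Unary.All.Properties using (applyUpTo⁺₁)
open import Data.Nat using (ℕ; zero; suc; _+_; _*_; _∸_; _^_; _⊓_; _⊔_; _≤_; _<_; s≤s; z≤n; NonZero; nonTrivial⇒n>1)
open import Data.Nat.Coprimality using (Coprime; coprime-divisor)
open import Data.Nat.Divisibility using (_∣_; _∣?_; divides; ∣-refl; ∣-trans; n∣m*n; ∣1⇒≡1; *-cancelˡ-∣; ∣⇒≤)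
open import Data.Nat.DivMod using (m*n/n≡m)
open import Data.Nat.GCD using (gcd; gcd-comm; gcd-zeroˡ; c*gcd[m,n]≡gcd[cm,cn])
open import Data.Nat.Induction using (<-rec)
open import Data.Nat.ListAction using (sum; product)
open import Data.Nat.ListAction.Properties using (product-++)
open import Data.Nat.Primality using (Prime; prime⇒irreducible; prime⇒nonZero; prime⇒nonTrivial)
open import Data.Nat.Properties
open import Algebra.Properties.CommutativeSemigroup +-commutativeSemigroup using () renaming (interchange to +-interchange)
open import Algebra.Properties.CommutativeSemigroup *-commutativeSemigroup using () renaming (interchange to *-interchange)
open import Data.Nat.Tactic.RingSolver using (solve-∀)
open import Data.Product using (∃-syntax; _×_; _,_; proj₁; proj₂)
open import Data.Sign using () renaming (+ to s+; - to s-)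
open import Data.Sum using (_⊎_; inj₁; inj₂)
open import Data.Unit using (tt)
open import Function using (_∘_)
open import Function.Bundles using (mk⇔)
open import Relation.Nullary using (¬_; yes; no; does; contradiction)
open import Relation.Nullary.Decidable using (does-⇔; dec-true; dec-false; T?)
open import Relation.Binary.PropositionalEquality

module FiniteSum {A : Set} {_∙_ : A → A → A} {ε : A} (isMonoid : IsMonoid _≡_ _∙_ ε) where
  open IsMonoid isMonoid using (assoc; identityˡ; identityʳ)

  ∑ : ℕ → (ℕ → A) → A
  ∑ n f = foldr _∙_ ε (applyUpTo f n)

  ∑-cong : ∀ n {f g : ℕ → A} → (∀ i → i < n → f i ≡ g i) → ∑ n f ≡ ∑ n g
  ∑-cong zero    f≡g = refl
  ∑-cong (suc n) f≡g = cong₂ _∙_ (f≡g 0 (s≤s z≤n)) (∑-cong n (λ i i<n → f≡g (suc i) (s≤s i<n)))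

  ∑-last : ∀ n (f : ℕ → A) → ∑ (suc n) f ≡ ∑ n f ∙ f n
  ∑-last zero    f = trans (identityʳ (f 0)) (sym (identityˡ (f 0)))
  ∑-last (suc n) f = trans (cong (f 0 ∙_) (∑-last n (λ i → f (suc i)))) (sym (assoc _ _ _))

  ∑-zero : ∀ n (f : ℕ → A) → (∀ i → i < n → f i ≡ ε) → ∑ n f ≡ ε
  ∑-zero zero    f f≡ε = refl
  ∑-zero (suc n) f f≡ε =
    trans (cong₂ _∙_ (f≡ε 0 (s≤s z≤n)) (∑-zero n (λ i → f (suc i)) (λ i i<n → f≡ε (suc i) (s≤s i<n))))
          (identityʳ ε)

open FiniteSum +-0-isMonoid

∑-+ : ∀ n (f g : ℕ → ℕ) → ∑ n (λ i → f i + g i) ≡ ∑ n f + ∑ n g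
∑-+ zero    f g = refl
∑-+ (suc n) f g = trans (cong (_+_ (f 0 + g 0)) (∑-+ n (λ i → f (suc i)) (λ i → g (suc i))))
                       (+-interchange (f 0) (g 0) _ _)

∑-*ʳ : ∀ n (f : ℕ → ℕ) x → ∑ n (λ i → f i * x) ≡ ∑ n f * x
∑-*ʳ zero    f x = refl
∑-*ʳ (suc n) f x = trans (cong (_+_ (f 0 * x)) (∑-*ʳ n (λ i → f (suc i)) x)) (sym (*-distribʳ-+ x (f 0) _))

∑-const : ∀ n c → ∑ n (λ _ → c) ≡ n * c
∑-const zero    c = refl
∑-const (suc n) c = cong (_+_ c) (∑-const n c)

∑-zeros : ∀ n → ∑ n (λ _ → 0) ≡ 0
∑-zeros n = trans (∑-const n 0) (*-zeroʳ n)

-- u (2 + k) − 2 u (1 + k) + u k = d, stated without truncated subtraction.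
record SecondDiff (u : ℕ → ℕ) (k d : ℕ) : Set where
  constructor secondDiff
  field equation : u (2 + k) + u k ≡ 2 * u (1 + k) + d

SecondDiff-+ : ∀ {u v : ℕ → ℕ} {k d e} → SecondDiff u k d → SecondDiff v k e →
               SecondDiff (λ i → u i + v i) k (d + e)
SecondDiff-+ {u} {v} {k} {d} {e} (secondDiff Δu) (secondDiff Δv) = secondDiff (begin
  (u (2 + k) + v (2 + k)) + (u k + v k)      ≡⟨ +-interchange (u (2 + k)) (v (2 + k)) (u k) (v k) ⟩
  (u (2 + k) + u k) + (v (2 + k) + v k)      ≡⟨ cong₂ _+_ Δu Δv ⟩
  (2 * u (1 + k) + d) + (2 * v (1 + k) + e)  ≡⟨ collect (u (1 + k)) (v (1 + k)) d e ⟩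
  2 * (u (1 + k) + v (1 + k)) + (d + e)      ∎)
  where
  open ≡-Reasoning
  collect : ∀ a b d e → (2 * a + d) + (2 * b + e) ≡ 2 * (a + b) + (d + e)
  collect = solve-∀

SecondDiff-*ʳ : ∀ {u : ℕ → ℕ} {k d} x → SecondDiff u k d → SecondDiff (λ i → u i * x) k (d * x)
SecondDiff-*ʳ {u} {k} {d} x (secondDiff Δu) = secondDiff (begin
  u (2 + k) * x + u k * x     ≡⟨ sym (*-distribʳ-+ x (u (2 + k)) (u k)) ⟩
  (u (2 + k) + u k) * x       ≡⟨ cong (_* x) Δu ⟩
  (2 * u (1 + k) + d) * x     ≡⟨ distrib (u (1 + k)) d x ⟩
  2 * (u (1 + k) * x) + d * x ∎)
  where
  open ≡-Reasoning
  distrib : ∀ a d x → (2 * a + d) * x ≡ 2 * (a * x) + d * x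
  distrib = solve-∀

SecondDiff-shift : ∀ {u v : ℕ → ℕ} {k d} → (∀ i → v (2 + i) ≡ u i) → SecondDiff u k d → SecondDiff v (2 + k) d
SecondDiff-shift {u} {v} {k} {d} v≗u (secondDiff Δu) = secondDiff (begin
  v (4 + k) + v (2 + k)  ≡⟨ cong₂ _+_ (v≗u (2 + k)) (v≗u k) ⟩
  u (2 + k) + u k        ≡⟨ Δu ⟩
  2 * u (1 + k) + d      ≡⟨ cong (λ x → 2 * x + d) (sym (v≗u (1 + k))) ⟩
  2 * v (3 + k) + d      ∎)
  where open ≡-Reasoning

m⊓n+m⊔n≡m+n : ∀ m n → (m ⊓ n) + (m ⊔ n) ≡ m + n
m⊓n+m⊔n≡m+n m n with ≤-total m n
... | inj₁ m≤n = cong₂ _+_ (m≤n⇒m⊓n≡m m≤n) (m≤n⇒m⊔n≡n m≤n)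
... | inj₂ n≤m = trans (cong₂ _+_ (m≥n⇒m⊓n≡n n≤m) (m≥n⇒m⊔n≡m n≤m)) (+-comm n m)

minPart maxPart : ℕ → ℕ → ℕ
minPart k a = a ⊓ (k ∸ a)
maxPart k a = a ⊔ (k ∸ a)

module _ {k a : ℕ} (a≤k : a ≤ k) where

  private
    2+k∸1+a : 2 + k ∸ (1 + a) ≡ 1 + (k ∸ a)
    2+k∸1+a = +-∸-assoc 1 a≤k

  minPart-suc : minPart (2 + k) (1 + a) ≡ 1 + minPart k a
  minPart-suc = cong (suc a ⊓_) 2+k∸1+a

  maxPart-suc : maxPart (2 + k) (1 + a) ≡ 1 + maxPart k a
  maxPart-suc = cong (suc a ⊔_) 2+k∸1+a

  minPart≤k : minPart k a ≤ k
  minPart≤k = ≤-trans (m⊓n≤m a (k ∸ a)) a≤k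

  k∸minPart≡maxPart : k ∸ minPart k a ≡ maxPart k a
  k∸minPart≡maxPart = begin
    k ∸ minPart k a                          ≡⟨ cong (_∸ minPart k a) (sym (m+[n∸m]≡n a≤k)) ⟩
    (a + (k ∸ a)) ∸ minPart k a              ≡⟨ cong (_∸ minPart k a) (sym (m⊓n+m⊔n≡m+n a (k ∸ a))) ⟩
    (minPart k a + maxPart k a) ∸ minPart k a ≡⟨ m+n∸m≡n (minPart k a) (maxPart k a) ⟩
    maxPart k a                              ∎
    where open ≡-Reasoning

minPart-self : ∀ k → minPart k k ≡ 0
minPart-self k = trans (cong (k ⊓_) (n∸n≡0 k)) (⊓-zeroʳ k)

maxPart-self : ∀ k → maxPart k k ≡ k
maxPart-self k = trans (cong (k ⊔_) (n∸n≡0 k)) (⊔-identityʳ k)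

maxPartSum : ℕ → ℕ
maxPartSum k = ∑ (suc k) (maxPart k)

maxPartSum-step : ∀ k → maxPartSum (2 + k) ≡ (5 + 3 * k) + maxPartSum k
maxPartSum-step k = begin
  maxPartSum (2 + k)
    ≡⟨ cong (_+_ (2 + k)) (∑-last (suc k) (λ a → maxPart (2 + k) (suc a))) ⟩
  2 + k + (∑ (suc k) (λ a → maxPart (2 + k) (suc a)) + maxPart (2 + k) (2 + k))
    ≡⟨ cong₂ (λ x y → 2 + k + (x + y)) (∑-cong (suc k) (λ a a<1+k → maxPart-suc (≤-pred a<1+k))) (maxPart-self (2 + k)) ⟩
  2 + k + (∑ (suc k) (λ a → 1 + maxPart k a) + (2 + k))
    ≡⟨ cong (λ x → 2 + k + (x + (2 + k)))
            (trans (∑-+ (suc k) (λ _ → 1) (maxPart k)) (cong (_+ maxPartSum k) (∑-const (suc k) 1))) ⟩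
  2 + k + ((suc k * 1 + maxPartSum k) + (2 + k))
    ≡⟨ collect k (maxPartSum k) ⟩
  (5 + 3 * k) + maxPartSum k ∎
  where
  open ≡-Reasoning
  collect : ∀ k s → 2 + k + ((suc k * 1 + s) + (2 + k)) ≡ (5 + 3 * k) + s
  collect = solve-∀

maxPartSum-secondDiff-step : ∀ {k d} → SecondDiff maxPartSum k d → SecondDiff maxPartSum (2 + k) d
maxPartSum-secondDiff-step Δ = SecondDiff-shift maxPartSum-step (SecondDiff-+ (linear _) Δ)
  where
  linear-identity : ∀ k → (5 + 3 * (2 + k)) + (5 + 3 * k) ≡ 2 * (5 + 3 * (1 + k)) + 0
  linear-identity = solve-∀
  linear : ∀ k → SecondDiff (λ i → 5 + 3 * i) k 0
  linear k = secondDiff (linear-identity k)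

maxPartSum-even : ∀ n → SecondDiff maxPartSum (n * 2) 1
maxPartSum-even zero    = secondDiff refl
maxPartSum-even (suc n) = maxPartSum-secondDiff-step (maxPartSum-even n)

maxPartSum-odd : ∀ n → SecondDiff maxPartSum (1 + n * 2) 2
maxPartSum-odd zero    = secondDiff refl
maxPartSum-odd (suc n) = maxPartSum-secondDiff-step (maxPartSum-odd n)

-- expA 0 (λ j → D (p ^ j)) k is the exponent of p in A(p ^ k), termA its part coming from m = p ^ a.
-- The weight w, added to every exponent, is what expA-step raises by 2.
termA : ℕ → (ℕ → ℕ) → ℕ → ℕ → ℕ
termA w S k a = ∑ (suc (minPart k a)) (λ j → (w + (j + maxPart k a)) * S j)

expA : ℕ → (ℕ → ℕ) → ℕ → ℕ
expA w S k = ∑ (suc k) (termA w S k)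

expA-step : ∀ w S k → expA w S (2 + k) ≡ ((3 + k) * w + maxPartSum (2 + k)) * S 0 + expA (2 + w) (S ∘ suc) k
expA-step w S k = begin
  expA w S (2 + k)
    ≡⟨ ∑-+ (3 + k) (λ a → (w + maxPart (2 + k) a) * S 0) rest ⟩
  ∑ (3 + k) (λ a → (w + maxPart (2 + k) a) * S 0) + ∑ (3 + k) rest
    ≡⟨ cong₂ _+_ head-terms rest-terms ⟩
  ((3 + k) * w + maxPartSum (2 + k)) * S 0 + expA (2 + w) (S ∘ suc) k ∎
  where
  open ≡-Reasoning
  rest : ℕ → ℕ
  rest a = ∑ (minPart (2 + k) a) (λ j → (w + (suc j + maxPart (2 + k) a)) * S (suc j))

  head-terms : ∑ (3 + k) (λ a → (w + maxPart (2 + k) a) * S 0) ≡ ((3 + k) * w + maxPartSum (2 + k)) * S 0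
  head-terms = trans (∑-*ʳ (3 + k) (λ a → w + maxPart (2 + k) a) (S 0))
    (cong (_* S 0) (trans (∑-+ (3 + k) (λ _ → w) (maxPart (2 + k))) (cong (_+ maxPartSum (2 + k)) (∑-const (3 + k) w))))

  reweigh : ∀ j m → w + (suc j + suc m) ≡ 2 + w + (j + m)
  reweigh = solve-∀

  rest-suc : ∀ a → a < suc k → rest (suc a) ≡ termA (2 + w) (S ∘ suc) k a
  rest-suc a a<1+k = begin
    rest (suc a)
      ≡⟨ cong₂ (λ t m → ∑ t (λ j → (w + (suc j + m)) * S (suc j))) (minPart-suc a≤k) (maxPart-suc a≤k) ⟩
    ∑ (suc (minPart k a)) (λ j → (w + (suc j + suc (maxPart k a))) * S (suc j))
      ≡⟨ ∑-cong (suc (minPart k a)) (λ j _ → cong (_* S (suc j)) (reweigh j (maxPart k a))) ⟩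
    termA (2 + w) (S ∘ suc) k a ∎
    where
    a≤k : a ≤ k
    a≤k = ≤-pred a<1+k

  rest-terms : ∑ (3 + k) rest ≡ expA (2 + w) (S ∘ suc) k
  rest-terms = begin
    ∑ (2 + k) (λ a → rest (suc a))
      ≡⟨ ∑-last (suc k) (λ a → rest (suc a)) ⟩
    ∑ (suc k) (λ a → rest (suc a)) + rest (2 + k)
      ≡⟨ cong₂ _+_ (∑-cong (suc k) rest-suc)
                   (cong (λ t → ∑ t (λ j → (w + (suc j + maxPart (2 + k) (2 + k))) * S (suc j))) (minPart-self (2 + k))) ⟩
    expA (2 + w) (S ∘ suc) k + 0
      ≡⟨ +-identityʳ _ ⟩
    expA (2 + w) (S ∘ suc) k ∎

expA-zero : ∀ w S → expA w S 0 ≡ w * S 0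
expA-zero w S = normalise w (S 0)
  where
  normalise : ∀ w s → (w + 0) * s + 0 + 0 ≡ w * s
  normalise = solve-∀

expA-one : ∀ w S → expA w S 1 ≡ 2 * ((1 + w) * S 0)
expA-one w S = normalise w (S 0)
  where
  normalise : ∀ w s → ((w + 1) * s + 0) + (((w + 1) * s + 0) + 0) ≡ 2 * ((1 + w) * s)
  normalise = solve-∀

expA-two : ∀ w S → expA w S 2 ≡ (3 * w + 5) * S 0 + (2 + w) * S 1
expA-two w S = trans (expA-step w S 0) (cong (_+_ ((3 * w + 5) * S 0)) (expA-zero (2 + w) (S ∘ suc)))

stepCoefficient-secondDiff : ∀ w {k d} → SecondDiff maxPartSum (2 + k) d →
                             SecondDiff (λ i → (3 + i) * w + maxPartSum (2 + i)) k d
stepCoefficient-secondDiff w {k} {d} (secondDiff Δ) = SecondDiff-+ linear shifted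
  where
  linear-identity : ∀ w k → (3 + (2 + k)) * w + (3 + k) * w ≡ 2 * ((3 + (1 + k)) * w) + 0
  linear-identity = solve-∀
  linear : SecondDiff (λ i → (3 + i) * w) k 0
  linear = secondDiff (linear-identity w k)
  shifted : SecondDiff (λ i → maxPartSum (2 + i)) k d
  shifted = secondDiff Δ

expA-even : ∀ n w S → SecondDiff (expA w S) (n * 2) (∑ (suc n) S + (w + suc n * 2) * S (suc n))
expA-even zero w S = secondDiff (begin
  expA w S 2 + expA w S 0
    ≡⟨ cong₂ _+_ (expA-two w S) (expA-zero w S) ⟩
  ((3 * w + 5) * S 0 + (2 + w) * S 1) + w * S 0
    ≡⟨ arithmetic w (S 0) (S 1) ⟩
  2 * (2 * ((1 + w) * S 0)) + (S 0 + 0 + (w + 2) * S 1)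
    ≡⟨ cong (λ x → 2 * x + (S 0 + 0 + (w + 2) * S 1)) (sym (expA-one w S)) ⟩
  2 * expA w S 1 + (S 0 + 0 + (w + 2) * S 1) ∎)
  where
  open ≡-Reasoning
  arithmetic : ∀ w a b → ((3 * w + 5) * a + (2 + w) * b) + w * a ≡ 2 * (2 * ((1 + w) * a)) + (a + 0 + (w + 2) * b)
  arithmetic = solve-∀
expA-even (suc n) w S =
  SecondDiff-shift (expA-step w S)
    (subst (SecondDiff _ (n * 2)) (collect (S 0) (∑ (suc n) (S ∘ suc)) w (suc n * 2) (S (2 + n)))
      (SecondDiff-+ (SecondDiff-*ʳ (S 0) (stepCoefficient-secondDiff w (maxPartSum-even (suc n)))) (expA-even n (2 + w) (S ∘ suc))))
  where
  collect : ∀ s t w m x → 1 * s + (t + (2 + w + m) * x) ≡ (s + t) + (w + (2 + m)) * x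
  collect = solve-∀

expA-odd : ∀ n w S → SecondDiff (expA w S) (1 + n * 2) (2 * ∑ (2 + n) S)
expA-odd zero w S = secondDiff (begin
  expA w S 3 + expA w S 1
    ≡⟨ cong₂ _+_ (trans (expA-step w S 1) (cong (_+_ ((4 * w + 10) * S 0)) (expA-one (2 + w) (S ∘ suc)))) (expA-one w S) ⟩
  ((4 * w + 10) * S 0 + 2 * ((3 + w) * S 1)) + 2 * ((1 + w) * S 0)
    ≡⟨ arithmetic w (S 0) (S 1) ⟩
  2 * ((3 * w + 5) * S 0 + (2 + w) * S 1) + 2 * (S 0 + (S 1 + 0))
    ≡⟨ cong (λ x → 2 * x + 2 * (S 0 + (S 1 + 0))) (sym (expA-two w S)) ⟩
  2 * expA w S 2 + 2 * (S 0 + (S 1 + 0)) ∎)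
  where
  open ≡-Reasoning
  arithmetic : ∀ w a b → ((4 * w + 10) * a + 2 * ((3 + w) * b)) + 2 * ((1 + w) * a)
                     ≡ 2 * ((3 * w + 5) * a + (2 + w) * b) + 2 * (a + (b + 0))
  arithmetic = solve-∀
expA-odd (suc n) w S =
  SecondDiff-shift (expA-step w S)
    (subst (SecondDiff _ (1 + n * 2)) (sym (*-distribˡ-+ 2 (S 0) (∑ (2 + n) (S ∘ suc))))
      (SecondDiff-+ (SecondDiff-*ʳ (S 0) (stepCoefficient-secondDiff w (maxPartSum-odd (suc n))))
                    (expA-odd n (2 + w) (S ∘ suc))))

-- σ₀⁻¹ (p ^ e): the coefficients of (1 − X)², the inverse of Σ (e + 1) Xᵉ.
μ⋆μ : ℕ → ℤ
μ⋆μ 0                       = + 1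
μ⋆μ 1                       = -[1+ 1 ]
μ⋆μ 2                       = + 1
μ⋆μ (suc (suc (suc _)))     = + 0

2+n∸a≡3+n∸1+a : ∀ n a → a < n → 2 + n ∸ a ≡ 3 + (n ∸ suc a)
2+n∸a≡3+n∸1+a (suc n) zero    _         = refl
2+n∸a≡3+n∸1+a (suc n) (suc a) (s≤s a<n) = 2+n∸a≡3+n∸1+a n a a<n

module _ {A : Set} {_∙_ : A → A → A} {ε : A} (isMonoid : IsMonoid _≡_ _∙_ ε) where
  open FiniteSum isMonoid using () renaming (∑ to ∑ᴹ; ∑-last to ∑ᴹ-last; ∑-zero to ∑ᴹ-zero)

  ∑-μ⋆μ : ∀ n (t : ℕ → ℤ → A) → (∀ a → t a (+ 0) ≡ ε) →
          ∑ᴹ (3 + n) (λ a → t a (μ⋆μ (2 + n ∸ a))) ≡ ((ε ∙ t n (+ 1)) ∙ t (1 + n) -[1+ 1 ]) ∙ t (2 + n) (+ 1)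
  ∑-μ⋆μ n t t[a,0]≡ε = begin
    ∑ᴹ (3 + n) u                              ≡⟨ ∑ᴹ-last (2 + n) u ⟩
    ∑ᴹ (2 + n) u ∙ u (2 + n)                  ≡⟨ cong (_∙ u (2 + n)) (∑ᴹ-last (1 + n) u) ⟩
    (∑ᴹ (1 + n) u ∙ u (1 + n)) ∙ u (2 + n)    ≡⟨ cong (λ x → (x ∙ u (1 + n)) ∙ u (2 + n)) (∑ᴹ-last n u) ⟩
    ((∑ᴹ n u ∙ u n) ∙ u (1 + n)) ∙ u (2 + n)
      ≡⟨ cong₂ (λ x y → ((x ∙ y) ∙ u (1 + n)) ∙ u (2 + n))
               (∑ᴹ-zero n u below) (cong (t n ∘ μ⋆μ) (m+n∸n≡m 2 n)) ⟩
    ((ε ∙ t n (+ 1)) ∙ u (1 + n)) ∙ u (2 + n)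
      ≡⟨ cong₂ (λ x y → ((ε ∙ t n (+ 1)) ∙ t (1 + n) (μ⋆μ x)) ∙ t (2 + n) (μ⋆μ y))
               (m+n∸n≡m 1 n) (n∸n≡0 (2 + n)) ⟩
    ((ε ∙ t n (+ 1)) ∙ t (1 + n) -[1+ 1 ]) ∙ t (2 + n) (+ 1) ∎
    where
    open ≡-Reasoning
    u : ℕ → A
    u a = t a (μ⋆μ (2 + n ∸ a))
    below : ∀ a → a < n → u a ≡ ε
    below a a<n = trans (cong (t a ∘ μ⋆μ) (2+n∸a≡3+n∸1+a n a a<n)) (t[a,0]≡ε a)

module ℤSum = FiniteSum ℤ.+-0-isMonoid
open ℤSum using () renaming (∑ to ∑ℤ)

-- (σ₀ ⋆ h) (p ^ e) for H e = h (p ^ e), as σ₀ (p ^ a) = a + 1.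
σ₀Conv : (ℕ → ℤ) → ℕ → ℤ
σ₀Conv H e = ∑ℤ (suc e) (λ a → + suc a ℤ.* H (e ∸ a))

σ₀Conv-injective : ∀ {H G : ℕ → ℤ} → (∀ e → σ₀Conv H e ≡ σ₀Conv G e) → ∀ e → H e ≡ G e
σ₀Conv-injective {H} {G} H≈G = <-rec (λ e → H e ≡ G e) step
  where
  tail : (ℕ → ℤ) → ℕ → ℤ
  tail F e = ∑ℤ e (λ a → + suc (suc a) ℤ.* F (e ∸ suc a))
  step : ∀ e → (∀ {i} → i < e → H i ≡ G i) → H e ≡ G e
  step e ih = begin
    H e             ≡⟨ ℤ.*-identityˡ (H e) ⟨
    + 1 ℤ.* H e     ≡⟨ ∙-cancelʳ (tail G e) (+ 1 ℤ.* H e) (+ 1 ℤ.* G e)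
                                  (trans (cong (ℤ._+_ (+ 1 ℤ.* H e)) (sym tails)) (H≈G e)) ⟩
    + 1 ℤ.* G e     ≡⟨ ℤ.*-identityˡ (G e) ⟩
    G e             ∎
    where
    open ≡-Reasoning
    tails : tail H e ≡ tail G e
    tails = ℤSum.∑-cong e (λ a a<e → cong (+ suc (suc a) ℤ.*_) (ih (∸-monoʳ-< (s≤s z≤n) a<e)))

σ₀Conv-μ⋆μ-suc : ∀ e → σ₀Conv μ⋆μ (suc e) ≡ + 0
σ₀Conv-μ⋆μ-suc 0 = refl
σ₀Conv-μ⋆μ-suc 1 = refl
σ₀Conv-μ⋆μ-suc (suc (suc n)) =
  trans (cong (ℤ._+_ (+ 0)) (∑-μ⋆μ ℤ.+-0-isMonoid n (λ a y → + suc (suc a) ℤ.* y) (λ a → ℤ.*-zeroʳ (+ suc (suc a)))))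
        (cancels (+ n))
  where
  cancels : ∀ K → + 0 ℤ.+ (((+ 0 ℤ.+ (+ 2 ℤ.+ K) ℤ.* + 1) ℤ.+ (+ 3 ℤ.+ K) ℤ.* -[1+ 1 ]) ℤ.+ (+ 4 ℤ.+ K) ℤ.* + 1)
                  ≡ + 0
  cancels = ℤ.solve-∀

^-split : ∀ p {i j} → i ≤ j → p ^ j ≡ p ^ (j ∸ i) * p ^ i
^-split p {i} {j} i≤j = trans (cong (p ^_) (sym (m∸n+n≡m i≤j))) (^-distribˡ-+-* p (j ∸ i) i)

^-monoʳ-∣ : ∀ p {i j} → i ≤ j → p ^ i ∣ p ^ j
^-monoʳ-∣ p {i} {j} i≤j = divides (p ^ (j ∸ i)) (^-split p i≤j)

*-div'ʳ : ∀ m n → 0 < n → (m * n) div' n ≡ m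
*-div'ʳ m (suc n) _ = m*n/n≡m m (suc n)

^-div'-^ : ∀ p .{{_ : NonZero p}} {a k} → a ≤ k → (p ^ k) div' (p ^ a) ≡ p ^ (k ∸ a)
^-div'-^ p {a} {k} a≤k = begin
  (p ^ k) div' (p ^ a)                ≡⟨ cong (_div' (p ^ a)) (^-split p a≤k) ⟩
  (p ^ (k ∸ a) * p ^ a) div' (p ^ a)  ≡⟨ *-div'ʳ (p ^ (k ∸ a)) (p ^ a) (m^n>0 p a) ⟩
  p ^ (k ∸ a)                         ∎
  where open ≡-Reasoning

gcd-^-≤ : ∀ p {i j} → i ≤ j → gcd (p ^ i) (p ^ j) ≡ p ^ i
gcd-^-≤ p {i} {j} i≤j = begin
  gcd (p ^ i) (p ^ j)                    ≡⟨ cong₂ gcd (sym (*-identityʳ (p ^ i))) (trans (^-split p i≤j) (*-comm _ (p ^ i))) ⟩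
  gcd (p ^ i * 1) (p ^ i * p ^ (j ∸ i))  ≡⟨ sym (c*gcd[m,n]≡gcd[cm,cn] (p ^ i) 1 (p ^ (j ∸ i))) ⟩
  p ^ i * gcd 1 (p ^ (j ∸ i))            ≡⟨ cong (p ^ i *_) (gcd-zeroˡ (p ^ (j ∸ i))) ⟩
  p ^ i * 1                              ≡⟨ *-identityʳ (p ^ i) ⟩
  p ^ i                                  ∎
  where open ≡-Reasoning

gcd-^ : ∀ p i j → gcd (p ^ i) (p ^ j) ≡ p ^ (i ⊓ j)
gcd-^ p i j with ≤-total i j
... | inj₁ i≤j = trans (gcd-^-≤ p i≤j) (cong (p ^_) (sym (m≤n⇒m⊓n≡m i≤j)))
... | inj₂ j≤i = trans (gcd-comm (p ^ i) (p ^ j)) (trans (gcd-^-≤ p j≤i) (cong (p ^_) (sym (m≥n⇒m⊓n≡n j≤i))))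

^-distribʳ-* : ∀ m n k → (m * n) ^ k ≡ m ^ k * n ^ k
^-distribʳ-* m n zero    = refl
^-distribʳ-* m n (suc k) = trans (cong (m * n *_) (^-distribʳ-* m n k)) (*-interchange m n (m ^ k) (n ^ k))

applyUpTo-+ : ∀ {A : Set} (f : ℕ → A) m n → applyUpTo f (m + n) ≡ applyUpTo f m ++ applyUpTo (λ i → f (m + i)) n
applyUpTo-+ f zero    n = refl
applyUpTo-+ f (suc m) n = cong (f 0 ∷_) (applyUpTo-+ (f ∘ suc) m n)

filterᵇ-cong : ∀ {A : Set} {b c : A → Bool} {xs} → All (λ x → b x ≡ c x) xs → filterᵇ b xs ≡ filterᵇ c xs
filterᵇ-cong []                                   = refl
filterᵇ-cong {b = b} {c} {x ∷ _} (bx≡cx ∷ b≗c) with b x | c x | bx≡cx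
... | true  | .true  | refl = cong (x ∷_) (filterᵇ-cong b≗c)
... | false | .false | refl = filterᵇ-cong b≗c

posPart-s+◃ : ∀ n → posPart (s+ ◃ n) ≡ n
posPart-s+◃ zero    = refl
posPart-s+◃ (suc n) = refl

negPart-s+◃ : ∀ n → negPart (s+ ◃ n) ≡ 0
negPart-s+◃ zero    = refl
negPart-s+◃ (suc n) = refl

posPart-s-◃ : ∀ n → posPart (s- ◃ n) ≡ 0
posPart-s-◃ zero    = refl
posPart-s-◃ (suc n) = refl

negPart-s-◃ : ∀ n → negPart (s- ◃ n) ≡ n
negPart-s-◃ zero    = refl
negPart-s-◃ (suc n) = refl

posPart-* : ∀ c a → posPart (c ℤ.* a) ≡ posPart a * posPart c + negPart a * negPart c
posPart-* (+ m)    (+ n)    = trans (posPart-s+◃ (m * n)) (trans (*-comm m n) (sym (+-identityʳ (n * m))))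
posPart-* (+ m)    -[1+ n ] = trans (posPart-s-◃ (m * suc n)) (sym (*-zeroʳ (suc n)))
posPart-* -[1+ m ] (+ n)    = trans (posPart-s-◃ (suc m * n)) (sym (trans (+-identityʳ (n * 0)) (*-zeroʳ n)))
posPart-* -[1+ m ] -[1+ n ] = trans (posPart-s+◃ (suc m * suc n)) (*-comm (suc m) (suc n))

negPart-* : ∀ c a → negPart (c ℤ.* a) ≡ posPart a * negPart c + negPart a * posPart c
negPart-* (+ m)    (+ n)    = trans (negPart-s+◃ (m * n)) (sym (trans (+-identityʳ (n * 0)) (*-zeroʳ n)))
negPart-* (+ m)    -[1+ n ] = trans (negPart-s-◃ (m * suc n)) (*-comm m (suc n))
negPart-* -[1+ m ] (+ n)    = trans (negPart-s-◃ (suc m * n)) (trans (*-comm (suc m) n) (sym (+-identityʳ (n * suc m))))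
negPart-* -[1+ m ] -[1+ n ] = trans (negPart-s+◃ (suc m * suc n)) (sym (*-zeroʳ (suc n)))

-- posProd and negProd are prodWith posPart and prodWith negPart, definitionally.
prodWith : (ℤ → ℕ) → LogComb → ℕ
prodWith π xs = product (map (λ x → proj₂ x ^ π (proj₁ x)) xs)

prodWith-scaleᴸ : ∀ π c {u v} → (∀ a → π (c ℤ.* a) ≡ posPart a * u + negPart a * v) →
                  ∀ xs → prodWith π (scaleᴸ c xs) ≡ posProd xs ^ u * negProd xs ^ v
prodWith-scaleᴸ π c {u} {v} π[c*a] []             = sym (cong₂ _*_ (^-zeroˡ u) (^-zeroˡ v))
prodWith-scaleᴸ π c {u} {v} π[c*a] ((a , n) ∷ xs) = begin
  n ^ π (c ℤ.* a) * prodWith π (scaleᴸ c xs)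
    ≡⟨ cong₂ _*_ (cong (n ^_) (π[c*a] a)) (prodWith-scaleᴸ π c π[c*a] xs) ⟩
  n ^ (posPart a * u + negPart a * v) * (P ^ u * N ^ v)
    ≡⟨ cong (_* (P ^ u * N ^ v)) (trans (^-distribˡ-+-* n (posPart a * u) (negPart a * v))
                                        (sym (cong₂ _*_ (^-*-assoc n (posPart a) u) (^-*-assoc n (negPart a) v)))) ⟩
  (n ^ posPart a) ^ u * (n ^ negPart a) ^ v * (P ^ u * N ^ v)
    ≡⟨ *-interchange ((n ^ posPart a) ^ u) ((n ^ negPart a) ^ v) (P ^ u) (N ^ v) ⟩
  (n ^ posPart a) ^ u * P ^ u * ((n ^ negPart a) ^ v * N ^ v)
    ≡⟨ sym (cong₂ _*_ (^-distribʳ-* (n ^ posPart a) P u) (^-distribʳ-* (n ^ negPart a) N v)) ⟩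
  (n ^ posPart a * P) ^ u * (n ^ negPart a * N) ^ v ∎
  where
  open ≡-Reasoning
  P N : ℕ
  P = posProd xs
  N = negProd xs

-- xs represents (P − N) · log p.
record HasExponents (p : ℕ) (xs : LogComb) (P N : ℕ) : Set where
  constructor _,_
  field
    posProd≡ : posProd xs ≡ p ^ P
    negProd≡ : negProd xs ≡ p ^ N

module _ {p : ℕ} where

  HasExponents-resp : ∀ {xs ys P Q N M} → xs ≡ ys → P ≡ Q → N ≡ M → HasExponents p xs P N → HasExponents p ys Q M
  HasExponents-resp refl refl refl xs-exps = xs-exps

  HasExponents-++ : ∀ {xs ys P N P′ N′} → HasExponents p xs P N → HasExponents p ys P′ N′ →
                    HasExponents p (xs ++ ys) (P + P′) (N + N′)
  HasExponents-++ {xs} {ys} {P} {N} {P′} {N′} (xs⁺ , xs⁻) (ys⁺ , ys⁻) =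
    prodWith-++ posPart {P} {P′} xs⁺ ys⁺ , prodWith-++ negPart {N} {N′} xs⁻ ys⁻
    where
    prodWith-++ : ∀ π {E E′} → prodWith π xs ≡ p ^ E → prodWith π ys ≡ p ^ E′ →
                  prodWith π (xs ++ ys) ≡ p ^ (E + E′)
    prodWith-++ π {E} {E′} xs-π ys-π = begin
      prodWith π (xs ++ ys)         ≡⟨ cong product (map-++ _ xs ys) ⟩
      product (map _ xs ++ map _ ys) ≡⟨ product-++ (map _ xs) (map _ ys) ⟩
      prodWith π xs * prodWith π ys ≡⟨ cong₂ _*_ xs-π ys-π ⟩
      p ^ E * p ^ E′                ≡⟨ sym (^-distribˡ-+-* p E E′) ⟩
      p ^ (E + E′)                  ∎
      where open ≡-Reasoning

  HasExponents-concatMap : ∀ {A : Set} (f : A → LogComb) (g : ℕ → A) n {P N : ℕ → ℕ} →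
                           (∀ i → i < n → HasExponents p (f (g i)) (P i) (N i)) →
                           HasExponents p (concatMap f (applyUpTo g n)) (∑ n P) (∑ n N)
  HasExponents-concatMap f g zero    f∘g = refl , refl
  HasExponents-concatMap f g (suc n) f∘g =
    HasExponents-++ (f∘g 0 (s≤s z≤n)) (HasExponents-concatMap f (g ∘ suc) n (λ i i<n → f∘g (suc i) (s≤s i<n)))

  HasExponents-map : ∀ {A : Set} (f : A → ℤ × ℕ) (g : ℕ → A) n {P N : ℕ → ℕ} →
                     (∀ i → i < n → HasExponents p (f (g i) ∷ []) (P i) (N i)) →
                     HasExponents p (map f (applyUpTo g n)) (∑ n P) (∑ n N)
  HasExponents-map f g n f∘g = HasExponents-resp map≡concatMap refl refl (HasExponents-concatMap (λ x → f x ∷ []) g n f∘g)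
    where
    map≡concatMap : concatMap (λ x → f x ∷ []) (applyUpTo g n) ≡ map f (applyUpTo g n)
    map≡concatMap = trans (sym (concatMap-map (_∷ []) f (applyUpTo g n))) (concatMap-pure (map f (applyUpTo g n)))

  HasExponents-p^ : ∀ c e → HasExponents p ((+ c , p ^ e) ∷ []) (e * c) 0
  HasExponents-p^ c e = trans (*-identityʳ ((p ^ e) ^ c)) (^-*-assoc p e c) , refl

  HasExponents-scaleᴸ : ∀ c {xs P N} → HasExponents p xs P N →
                        HasExponents p (scaleᴸ c xs) (P * posPart c + N * negPart c) (P * negPart c + N * posPart c)
  HasExponents-scaleᴸ c {xs} {P} {N} (xs⁺ , xs⁻) =
    trans (prodWith-scaleᴸ posPart c (posPart-* c) xs) (powers (posPart c) (negPart c)) ,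
    trans (prodWith-scaleᴸ negPart c (negPart-* c) xs) (powers (negPart c) (posPart c))
    where
    powers : ∀ u v → posProd xs ^ u * negProd xs ^ v ≡ p ^ (P * u + N * v)
    powers u v = begin
      posProd xs ^ u * negProd xs ^ v  ≡⟨ cong₂ (λ x y → x ^ u * y ^ v) xs⁺ xs⁻ ⟩
      (p ^ P) ^ u * (p ^ N) ^ v        ≡⟨ cong₂ _*_ (^-*-assoc p P u) (^-*-assoc p N v) ⟩
      p ^ (P * u) * p ^ (N * v)        ≡⟨ sym (^-distribˡ-+-* p (P * u) (N * v)) ⟩
      p ^ (P * u + N * v)              ∎
      where open ≡-Reasoning

  HasExponents⇒≈ᴸ : ∀ {xs T N} → HasExponents p xs (T + N) N → xs ≈ᴸ ((+ T , p) ∷ [])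
  HasExponents⇒≈ᴸ {xs} {T} {N} (xs⁺ , xs⁻) = begin
    posProd xs * 1            ≡⟨ cong (_* 1) xs⁺ ⟩
    p ^ (T + N) * 1           ≡⟨ *-identityʳ _ ⟩
    p ^ (T + N)               ≡⟨ ^-distribˡ-+-* p T N ⟩
    p ^ T * p ^ N             ≡⟨ cong₂ _*_ (sym (*-identityʳ (p ^ T))) (sym xs⁻) ⟩
    (p ^ T * 1) * negProd xs  ∎
    where open ≡-Reasoning

  HasExponents⇒≉[] : 1 < p → ∀ {xs T N} → 0 < T → HasExponents p xs (T + N) N → ¬ (xs ≈ᴸ [])
  HasExponents⇒≉[] 1<p {xs} {T} {N} 0<T (xs⁺ , xs⁻) xs≈[] = <⇒≢ (^-monoʳ-< p 1<p N<T+N) (sym p^[T+N]≡p^N)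
    where
    N<T+N : N < T + N
    N<T+N = +-monoˡ-< N 0<T
    p^[T+N]≡p^N : p ^ (T + N) ≡ p ^ N
    p^[T+N]≡p^N = trans (sym xs⁺) (trans (sym (*-identityʳ _)) (trans xs≈[] (trans (*-identityˡ _) xs⁻)))

sumℤ≡foldr : ∀ xs → sumℤ xs ≡ foldr ℤ._+_ (+ 0) xs
sumℤ≡foldr []       = refl
sumℤ≡foldr (x ∷ xs) = cong (ℤ._+_ x) (sumℤ≡foldr xs)

εᴰ-nontrivial : ∀ {n} → 1 < n → εᴰ n ≡ + 0
εᴰ-nontrivial {suc zero}    (s≤s ())
εᴰ-nontrivial {suc (suc n)} _ = refl

parity : ∀ m → ∃[ n ] (m ≡ n * 2 ⊎ m ≡ 1 + n * 2)
parity zero = 0 , inj₁ refl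
parity (suc m) with parity m
... | n , inj₁ m≡2n   = n , inj₂ (cong suc m≡2n)
... | n , inj₂ m≡1+2n = suc n , inj₁ (cong suc m≡1+2n)

module PrimePower {p : ℕ} (p-prime : Prime p) where

  private instance
    p≢0 : NonZero p
    p≢0 = prime⇒nonZero p-prime

  1<p : 1 < p
  1<p = nonTrivial⇒n>1 p {{prime⇒nonTrivial p-prime}}

  p^k<p^[1+k] : ∀ k → p ^ k < p ^ suc k
  p^k<p^[1+k] k = ^-monoʳ-< p 1<p (n<1+n k)

  ∤⇒coprime : ∀ {d} → ¬ p ∣ d → Coprime d p
  ∤⇒coprime p∤d (i∣d , i∣p) with prime⇒irreducible p-prime i∣p
  ... | inj₁ i≡1  = i≡1
  ... | inj₂ refl = contradiction i∣d p∤d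

  ∣p^⇒≡p^ : ∀ {d} k → d ∣ p ^ k → ∃[ i ] i ≤ k × d ≡ p ^ i
  ∣p^⇒≡p^ zero d∣1 = 0 , z≤n , ∣1⇒≡1 d∣1
  ∣p^⇒≡p^ {d} (suc k) d∣p^[1+k] with p ∣? d
  ... | yes (divides e refl) with ∣p^⇒≡p^ k (*-cancelˡ-∣ p (subst (_∣ p ^ suc k) (*-comm e p) d∣p^[1+k]))
  ...   | i , i≤k , refl = suc i , s≤s i≤k , *-comm (p ^ i) p
  ∣p^⇒≡p^ {d} (suc k) d∣p^[1+k] | no p∤d with ∣p^⇒≡p^ k (coprime-divisor (∤⇒coprime p∤d) d∣p^[1+k])
  ...   | i , i≤k , d≡p^i = i , m≤n⇒m≤1+n i≤k , d≡p^i

  ∣p^[1+k]⇒∣p^k⊎≡ : ∀ {d} k → d ∣ p ^ suc k → d ∣ p ^ k ⊎ d ≡ p ^ suc k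
  ∣p^[1+k]⇒∣p^k⊎≡ k d∣p^[1+k] with ∣p^⇒≡p^ (suc k) d∣p^[1+k]
  ... | i , i≤1+k , refl with m≤n⇒m<n∨m≡n i≤1+k
  ...   | inj₁ i<1+k = inj₁ (^-monoʳ-∣ p (≤-pred i<1+k))
  ...   | inj₂ refl  = inj₂ refl

  divisors-p^ : ∀ k → divisors (p ^ k) ≡ applyUpTo (p ^_) (suc k)
  divisors-p^ k = trans (cong (filterᵇ (∣?ᵇ (p ^ k))) (map-upTo suc (p ^ k))) (divisorsUpTo-p^ k)
    where
    ∣?ᵇ : ℕ → ℕ → Bool
    ∣?ᵇ n d = does (d ∣? n)
    divisorsUpTo-p^ : ∀ k → filterᵇ (∣?ᵇ (p ^ k)) (applyUpTo suc (p ^ k)) ≡ applyUpTo (p ^_) (suc k)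
    divisorsUpTo-p^ zero = refl
    divisorsUpTo-p^ (suc k) with e , 1+p^k+e≡p^[1+k] ← m≤n⇒∃[o]m+o≡n (p^k<p^[1+k] k) = begin
      filterᵇ P (applyUpTo suc (p ^ suc k))
        ≡⟨ cong (filterᵇ P) range-split ⟩
      filterᵇ P ((applyUpTo suc (p ^ k) ++ applyUpTo between e) ∷ʳ p ^ suc k)
        ≡⟨ filter-++ (T? ∘ P) (applyUpTo suc (p ^ k) ++ applyUpTo between e) (p ^ suc k ∷ []) ⟩
      filterᵇ P (applyUpTo suc (p ^ k) ++ applyUpTo between e) ++ filterᵇ P (p ^ suc k ∷ [])
        ≡⟨ cong₂ _++_ (filter-++ (T? ∘ P) (applyUpTo suc (p ^ k)) (applyUpTo between e))
                      (filter-accept (T? ∘ P) (subst T (sym (dec-true (p ^ suc k ∣? p ^ suc k) ∣-refl)) tt)) ⟩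
      (filterᵇ P (applyUpTo suc (p ^ k)) ++ filterᵇ P (applyUpTo between e)) ∷ʳ p ^ suc k
        ≡⟨ cong₂ (λ xs ys → (xs ++ ys) ∷ʳ p ^ suc k) lower upper ⟩
      (applyUpTo (p ^_) (suc k) ++ []) ∷ʳ p ^ suc k
        ≡⟨ cong (_∷ʳ p ^ suc k) (++-identityʳ (applyUpTo (p ^_) (suc k))) ⟩
      applyUpTo (p ^_) (suc k) ∷ʳ p ^ suc k
        ≡⟨ applyUpTo-∷ʳ (p ^_) (suc k) ⟩
      applyUpTo (p ^_) (suc (suc k)) ∎
      where
      open ≡-Reasoning
      P : ℕ → Bool
      P = ∣?ᵇ (p ^ suc k)
      between : ℕ → ℕ
      between i = suc (p ^ k + i)

      range-split : applyUpTo suc (p ^ suc k) ≡ (applyUpTo suc (p ^ k) ++ applyUpTo between e) ∷ʳ p ^ suc k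
      range-split = begin
        applyUpTo suc (p ^ suc k)                     ≡⟨ cong (applyUpTo suc) (sym 1+p^k+e≡p^[1+k]) ⟩
        applyUpTo suc (suc (p ^ k + e))               ≡⟨ sym (applyUpTo-∷ʳ suc (p ^ k + e)) ⟩
        applyUpTo suc (p ^ k + e) ∷ʳ suc (p ^ k + e)  ≡⟨ cong₂ _∷ʳ_ (applyUpTo-+ suc (p ^ k) e) 1+p^k+e≡p^[1+k] ⟩
        (applyUpTo suc (p ^ k) ++ applyUpTo between e) ∷ʳ p ^ suc k ∎

      lower : filterᵇ P (applyUpTo suc (p ^ k)) ≡ applyUpTo (p ^_) (suc k)
      lower = trans (filterᵇ-cong (applyUpTo⁺₁ suc (p ^ k) same)) (divisorsUpTo-p^ k)
        where
        same : ∀ {d} → d < p ^ k → P (suc d) ≡ ∣?ᵇ (p ^ k) (suc d)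
        same {d} d<p^k = does-⇔ (mk⇔ to (λ d∣p^k → ∣-trans d∣p^k (n∣m*n p))) (suc d ∣? p ^ suc k) (suc d ∣? p ^ k)
          where
          to : suc d ∣ p ^ suc k → suc d ∣ p ^ k
          to d∣p^[1+k] with ∣p^[1+k]⇒∣p^k⊎≡ k d∣p^[1+k]
          ... | inj₁ d∣p^k = d∣p^k
          ... | inj₂ d≡p^[1+k] = contradiction (subst (_≤ p ^ k) d≡p^[1+k] d<p^k) (<⇒≱ (p^k<p^[1+k] k))

      upper : filterᵇ P (applyUpTo between e) ≡ []
      upper = filter-none (T? ∘ P) (applyUpTo⁺₁ between e (λ i<e → subst T (dec-false (_ ∣? _) (∤ i<e))))
        where
        ∤ : ∀ {i} → i < e → ¬ between i ∣ p ^ suc k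
        ∤ {i} i<e d∣p^[1+k] with ∣p^[1+k]⇒∣p^k⊎≡ k d∣p^[1+k]
        ... | inj₁ d∣p^k = <⇒≱ (s≤s (m≤m+n (p ^ k) i)) (∣⇒≤ {{m^n≢0 p k}} d∣p^k)
        ... | inj₂ d≡p^[1+k] = <⇒≢ (subst (between i <_) 1+p^k+e≡p^[1+k] (s≤s (+-monoʳ-< (p ^ k) i<e))) d≡p^[1+k]

  Dₚ : ℕ → ℕ
  Dₚ j = D (p ^ j)

  σ₀-p^ : ∀ k → σ₀ (p ^ k) ≡ suc k
  σ₀-p^ k = trans (cong length (divisors-p^ k)) (length-applyUpTo (p ^_) (suc k))

  logA-p^ : ∀ k → HasExponents p (logA (p ^ k)) (expA 0 Dₚ k) 0
  logA-p^ k = HasExponents-resp (cong (concatMap (entries ∘ gcdWithCofactor)) (sym (divisors-p^ k))) refl (∑-zeros (suc k))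
                                (HasExponents-concatMap (entries ∘ gcdWithCofactor) (p ^_) (suc k) term)
    where
    gcdWithCofactor : ℕ → ℕ
    gcdWithCofactor m = gcd m ((p ^ k) div' m)
    entries : ℕ → LogComb
    entries g = map (λ q → (+ D q , (q * p ^ k) div' g)) (divisors g)

    term : ∀ a → a < suc k → HasExponents p (entries (gcdWithCofactor (p ^ a))) (termA 0 Dₚ k a) 0
    term a a<1+k = HasExponents-resp (trans (cong (map entry) (sym (divisors-p^ t))) (cong entries (sym gcd≡p^t)))
                                     refl (∑-zeros (suc t))
                                     (HasExponents-map entry (p ^_) (suc t) (λ j _ → entry-exps j))
      where
      a≤k : a ≤ k
      a≤k = ≤-pred a<1+k
      t : ℕ
      t = minPart k a
      entry : ℕ → ℤ × ℕ
      entry q = (+ D q , (q * p ^ k) div' (p ^ t))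
      gcd≡p^t : gcdWithCofactor (p ^ a) ≡ p ^ t
      gcd≡p^t = trans (cong (gcd (p ^ a)) (^-div'-^ p a≤k)) (gcd-^ p a (k ∸ a))
      base : ∀ j → (p ^ j * p ^ k) div' (p ^ t) ≡ p ^ (j + maxPart k a)
      base j = begin
        (p ^ j * p ^ k) div' (p ^ t)  ≡⟨ cong (_div' (p ^ t)) (sym (^-distribˡ-+-* p j k)) ⟩
        (p ^ (j + k)) div' (p ^ t)    ≡⟨ ^-div'-^ p (≤-trans (minPart≤k a≤k) (m≤n+m k j)) ⟩
        p ^ (j + k ∸ t)
          ≡⟨ cong (p ^_) (trans (+-∸-assoc j (minPart≤k a≤k)) (cong (_+_ j) (k∸minPart≡maxPart a≤k))) ⟩
        p ^ (j + maxPart k a)         ∎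
        where open ≡-Reasoning
      entry-exps : ∀ j → HasExponents p (entry (p ^ j) ∷ []) ((j + maxPart k a) * Dₚ j) 0
      entry-exps j = HasExponents-resp (cong (λ n → (+ Dₚ j , n) ∷ []) (sym (base j))) refl refl
                                       (HasExponents-p^ (Dₚ j) (j + maxPart k a))

  module Inverse {h : ℕ → ℤ} (h-inv : IsσInverse h) where

    σ₀⋆h-p^ : ∀ e → ((λ k → + σ₀ k) ⋆ h) (p ^ e) ≡ σ₀Conv (λ e → h (p ^ e)) e
    σ₀⋆h-p^ e = begin
      sumℤ (map term (divisors (p ^ e)))             ≡⟨ cong (sumℤ ∘ map term) (divisors-p^ e) ⟩
      sumℤ (map term (applyUpTo (p ^_) (suc e)))     ≡⟨ cong sumℤ (map-applyUpTo (p ^_) term (suc e)) ⟩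
      sumℤ (applyUpTo (term ∘ (p ^_)) (suc e))       ≡⟨ sumℤ≡foldr (applyUpTo (term ∘ (p ^_)) (suc e)) ⟩
      ∑ℤ (suc e) (term ∘ (p ^_))
        ≡⟨ ℤSum.∑-cong (suc e) (λ a a<1+e → cong₂ (λ n d → + n ℤ.* h d) (σ₀-p^ a) (^-div'-^ p (≤-pred a<1+e))) ⟩
      σ₀Conv (λ e → h (p ^ e)) e                    ∎
      where
      open ≡-Reasoning
      term : ℕ → ℤ
      term d = + σ₀ d ℤ.* h ((p ^ e) div' d)

    h-p^ : ∀ e → h (p ^ e) ≡ μ⋆μ e
    h-p^ = σ₀Conv-injective (λ e → trans (sym (σ₀⋆h-p^ e)) (trans (h-inv (p ^ e) (m^n>0 p e)) (εᴰ-p^ e)))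
      where
      εᴰ-p^ : ∀ e → εᴰ (p ^ e) ≡ σ₀Conv μ⋆μ e
      εᴰ-p^ zero    = refl
      εᴰ-p^ (suc e) = trans (εᴰ-nontrivial (^-monoʳ-< p 1<p {0} {suc e} (s≤s z≤n))) (sym (σ₀Conv-μ⋆μ-suc e))

    posExp negExp : ℕ → ℕ
    posExp m = ∑ (suc m) (λ a → expA 0 Dₚ a * posPart (μ⋆μ (m ∸ a)))
    negExp m = ∑ (suc m) (λ a → expA 0 Dₚ a * negPart (μ⋆μ (m ∸ a)))

    Lᴬ-p^ : ∀ m → HasExponents p (Lᴬ h (p ^ m)) (posExp m) (negExp m)
    Lᴬ-p^ m = HasExponents-resp (cong (concatMap scaledLogA) (sym (divisors-p^ m))) refl refl
                                (HasExponents-concatMap scaledLogA (p ^_) (suc m) term)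
      where
      scaledLogA : ℕ → LogComb
      scaledLogA d = scaleᴸ (h ((p ^ m) div' d)) (logA d)
      term : ∀ a → a < suc m →
             HasExponents p (scaledLogA (p ^ a)) (expA 0 Dₚ a * posPart (μ⋆μ (m ∸ a))) (expA 0 Dₚ a * negPart (μ⋆μ (m ∸ a)))
      term a a<1+m = HasExponents-resp refl (exponent posPart) (exponent negPart) (HasExponents-scaleᴸ c (logA-p^ a))
        where
        c : ℤ
        c = h ((p ^ m) div' (p ^ a))
        c≡μ⋆μ : c ≡ μ⋆μ (m ∸ a)
        c≡μ⋆μ = trans (cong h (^-div'-^ p (≤-pred a<1+m))) (h-p^ (m ∸ a))
        exponent : (π : ℤ → ℕ) → expA 0 Dₚ a * π c + 0 ≡ expA 0 Dₚ a * π (μ⋆μ (m ∸ a))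
        exponent π = trans (+-identityʳ _) (cong (λ c → expA 0 Dₚ a * π c) c≡μ⋆μ)

    posExp-step : ∀ k → posExp (2 + k) ≡ expA 0 Dₚ (2 + k) + expA 0 Dₚ k
    posExp-step k = trans (∑-μ⋆μ +-0-isMonoid k (λ a y → expA 0 Dₚ a * posPart y) (λ a → *-zeroʳ (expA 0 Dₚ a)))
                          (collect (expA 0 Dₚ k) (expA 0 Dₚ (1 + k)) (expA 0 Dₚ (2 + k)))
      where
      collect : ∀ a b c → ((0 + a * 1) + b * 0) + c * 1 ≡ c + a
      collect = solve-∀

    negExp-step : ∀ k → negExp (2 + k) ≡ 2 * expA 0 Dₚ (1 + k)
    negExp-step k = trans (∑-μ⋆μ +-0-isMonoid k (λ a y → expA 0 Dₚ a * negPart y) (λ a → *-zeroʳ (expA 0 Dₚ a)))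
                          (collect (expA 0 Dₚ k) (expA 0 Dₚ (1 + k)) (expA 0 Dₚ (2 + k)))
      where
      collect : ∀ a b c → ((0 + a * 0) + b * 2) + c * 0 ≡ 2 * b
      collect = solve-∀

    posExp-secondDiff : ∀ {k d} → SecondDiff (expA 0 Dₚ) k d → posExp (2 + k) ≡ d + negExp (2 + k)
    posExp-secondDiff {k} {d} (secondDiff ΔF) = begin
      posExp (2 + k)                       ≡⟨ posExp-step k ⟩
      expA 0 Dₚ (2 + k) + expA 0 Dₚ k        ≡⟨ ΔF ⟩
      2 * expA 0 Dₚ (1 + k) + d             ≡⟨ +-comm _ d ⟩
      d + 2 * expA 0 Dₚ (1 + k)             ≡⟨ cong (_+_ d) (sym (negExp-step k)) ⟩
      d + negExp (2 + k)                   ∎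
      where open ≡-Reasoning

    sumD≡∑ : ∀ k → sumD p k ≡ ∑ k Dₚ
    sumD≡∑ k = cong sum (map-upTo Dₚ k)

    odd-exponents : ∀ n → posExp (1 + n * 2) ≡ 2 * sumD p (suc n) + negExp (1 + n * 2)
    odd-exponents zero = begin
      posExp 1                  ≡⟨ trans (+-identityʳ _) (*-identityʳ _) ⟩
      expA 0 Dₚ 1                ≡⟨ expA-one 0 Dₚ ⟩
      2 * sumD p 1              ≡⟨ sym (+-identityʳ _) ⟩
      2 * sumD p 1 + 0          ≡⟨ cong (_+_ (2 * sumD p 1)) (sym (trans (+-identityʳ _) (*-zeroʳ (expA 0 Dₚ 1)))) ⟩
      2 * sumD p 1 + negExp 1   ∎
      where open ≡-Reasoning
    odd-exponents (suc n) = trans (posExp-secondDiff (expA-odd n 0 Dₚ))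
                                  (cong (λ s → 2 * s + negExp (3 + n * 2)) (sym (sumD≡∑ (2 + n))))

    even-exponents : ∀ n → posExp (n * 2) ≡ (sumD p n + (n * 2) * Dₚ n) + negExp (n * 2)
    even-exponents zero    = refl
    even-exponents (suc n) = trans (posExp-secondDiff (expA-even n 0 Dₚ))
                                   (cong (λ s → (s + (suc n * 2) * Dₚ (suc n)) + negExp (suc n * 2)) (sym (sumD≡∑ (suc n))))

    Lᴬ-p^-≈ : ∀ m {T} → posExp m ≡ T + negExp m → Lᴬ h (p ^ m) ≈ᴸ ((+ T , p) ∷ [])
    Lᴬ-p^-≈ m P≡T+N = HasExponents⇒≈ᴸ (HasExponents-resp refl P≡T+N refl (Lᴬ-p^ m))

    Lᴬ-p^-≉[] : ∀ m {T} → 0 < T → posExp m ≡ T + negExp m → ¬ (Lᴬ h (p ^ m) ≈ᴸ [])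
    Lᴬ-p^-≉[] m 0<T P≡T+N = HasExponents⇒≉[] 1<p 0<T (HasExponents-resp refl P≡T+N refl (Lᴬ-p^ m))

lemma5p9 : (h : ℕ → ℤ) → IsσInverse h → (p : ℕ) → Prime p →
    ((n : ℕ) → Lᴬ h (p ^ (2 * n + 1)) ≈ᴸ ((+ (2 * sumD p (n + 1)) , p) ∷ []))
    × ((n : ℕ) → Lᴬ h (p ^ (2 * n)) ≈ᴸ ((+ (sumD p n + (2 * n) * D (p ^ n)) , p) ∷ []))
    × ((m : ℕ) → 1 ≤ m → ¬ (Lᴬ h (p ^ m) ≈ᴸ []))
lemma5p9 h h-inv p p-prime = odd , even , nonvanishing
  where
  open PrimePower p-prime
  open Inverse {h} h-inv

  odd : ∀ n → Lᴬ h (p ^ (2 * n + 1)) ≈ᴸ ((+ (2 * sumD p (n + 1)) , p) ∷ [])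
  odd n = subst₂ (λ m k → Lᴬ h (p ^ m) ≈ᴸ ((+ (2 * sumD p k) , p) ∷ []))
                 (trans (cong suc (*-comm n 2)) (+-comm 1 (2 * n))) (+-comm 1 n)
                 (Lᴬ-p^-≈ (1 + n * 2) {2 * sumD p (suc n)} (odd-exponents n))

  even : ∀ n → Lᴬ h (p ^ (2 * n)) ≈ᴸ ((+ (sumD p n + (2 * n) * D (p ^ n)) , p) ∷ [])
  even n = subst (λ m → Lᴬ h (p ^ m) ≈ᴸ ((+ (sumD p n + m * D (p ^ n)) , p) ∷ []))
                 (*-comm n 2) (Lᴬ-p^-≈ (n * 2) {sumD p n + (n * 2) * D (p ^ n)} (even-exponents n))

  -- D (p ^ 0) = D 1 evaluates to 1, which makes both exponents visibly positive.
  nonvanishing : ∀ m → 1 ≤ m → ¬ (Lᴬ h (p ^ m) ≈ᴸ [])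
  nonvanishing m 1≤m with parity m
  ... | n     , inj₂ refl = Lᴬ-p^-≉[] (1 + n * 2) {2 * sumD p (suc n)} (s≤s z≤n) (odd-exponents n)
  ... | zero  , inj₁ refl = contradiction 1≤m λ ()
  ... | suc n , inj₁ refl =
    Lᴬ-p^-≉[] (suc n * 2) {sumD p (suc n) + (suc n * 2) * D (p ^ suc n)} (s≤s z≤n) (even-exponents (suc n))
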